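{- For integers $m\ge1$ and $j\in[0,m]$ let $$\tau_m(j):=\sum_{i=0}^{m-j}\binom{m-i}{j}\binom{m-j}{i}.$$ Then there is an absolute constant $C>0$ such that for all $m\ge1$, $$\max\{\tau_m(j): 0\le j\le m\}\le C\,\frac{\phi^{2m}}{\sqrt m},$$ where $\phi=(1+\sqrt5)/2$. -}

module Defs where

open import Data.Nat using (ℕ; zero; suc; _+_; _*_; _∸_; _^_; _≤_; _⊔_)
open import Data.Nat.Combinatorics using (_C_)
open import Data.List using (List; map; upTo; foldr)
open import Data.Nat.ListAction using (sum)
open import Data.Sum using (_⊎_)

τ : ℕ → ℕ → ℕ
τ m j = sum (map (λ i → ((m ∸ i) C j) * ((m ∸ j) C i)) (upTo (suc (m ∸ j))))

maxτ : ℕ → ℕ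
maxτ m = foldr _⊔_ 0 (map (τ m) (upTo (suc m)))

-- Fibonacci and Lucas numbers; φ^k = (lucas k + fib k · √5) / 2 exactly.
fib : ℕ → ℕ
fib zero = 0
fib (suc zero) = 1
fib (suc (suc n)) = fib (suc n) + fib n

lucas : ℕ → ℕ
lucas zero = 2
lucas (suc zero) = 1
lucas (suc (suc n)) = lucas (suc n) + lucas n

_≤_+_√5 : ℕ → ℕ → ℕ → Set
a ≤ b + c √5 = (a ≤ b) ⊎ ((a ∸ b) ^ 2 ≤ 5 * c ^ 2)

_≤_·φ^_ : ℕ → ℕ → ℕ → Set
N ≤ K ·φ^ k = (2 * N) ≤ (K * lucas k) + (K * fib k) √5

{-# OPTIONS --safe #-}
-- Φ m and Ψ m below are positive linear functionals on ℕ → ℕ, and τ m j = Φ m (N ↦ C(N, j))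
-- because both sides satisfy the same second-order recurrence in (m, j). So τ m j is a mixture
-- of the binomial coefficients C(N, j), N ≤ m, of total weight Φ m 1 = 2ᵐ, while
-- Φ m (N ↦ 2ᴺ) = F(2m + 2) with 5 F(2m + 2)² + 2 = L(4m + 4).
-- Split the mixture at K = ⌊m / 16⌋. As C(N, j) ≤ 2ᴺ / √(N + 1), Minkowski's inequality bounds
-- the part N ≥ K by F(2m + 2) / √(K + 1) ≤ 4 F(2m + 2) / √m. The part N < K is at most 2ᵐ⁺ᴷ,
-- and 4ᵐ⁺ᴷ m = O(5ᵐ) = O(L(4m)) because 4¹⁷ᐟ¹⁶ < 5. Hence 2 τ m j² m ≤ C² L(4m), the first
-- disjunct of the exact comparison 2 τ m j² m ≤ C² (L(4m) + F(4m) √5) that encodes the bound.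
module Submission where

open import Defs
open import Data.Nat using (ℕ; zero; suc; pred; _+_; _*_; _^_; _∸_; _≤_; _<_; _>_; _≤ᵇ_; z≤n; s≤s; z<s; s<s; _/_; _%_)
open import Data.Nat.Properties
open import Data.Nat.DivMod using (m≡m%n+[m/n]*n; m%n<n)
open import Data.Nat.Combinatorics using (_C_; nCn≡1; nC1≡n; nCk≡nC[n∸k]; nCk+nC[k+1]≡[n+1]C[k+1])
open import Data.Nat.ListAction using (sum)
open import Data.Nat.ListAction.Properties using (sum-↭)
open import Data.Nat.Tactic.RingSolver using (solve-∀)
open import Algebra.Properties.CommutativeSemigroup +-commutativeSemigroup using (interchange)
open import Data.Bool using (true; false; T)
open import Data.Unit using (tt)
open import Data.Empty using (⊥-elim)
open import Data.List using (_∷_; map; upTo; applyUpTo; applyDownFrom; reverse)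
open import Data.List.Properties using (map-upTo; reverse-applyUpTo)
open import Data.List.Relation.Binary.Permutation.Propositional.Properties using (↭-reverse)
open import Data.List.Membership.Propositional using (_∈_)
open import Data.List.Membership.Propositional.Properties using (foldr-selective; ∈-applyUpTo⁻)
open import Data.Product using (∃-syntax; _×_; _,_; proj₁)
open import Data.Sum using (_⊎_; inj₁; inj₂; [_,_]′)
open import Function using (_∘_)
open import Relation.Binary.PropositionalEquality
open import Relation.Nullary using (yes; no)
open import Relation.Nullary.Decidable using (toWitness)

∑< : ℕ → (ℕ → ℕ) → ℕ
∑< n f = sum (applyUpTo f n)

syntax ∑< n (λ i → e) = ∑[ i < n ] e

∑<-cong : ∀ n {f g : ℕ → ℕ} → (∀ i → i < n → f i ≡ g i) → ∑< n f ≡ ∑< n g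
∑<-cong zero    f≡g = refl
∑<-cong (suc n) f≡g = cong₂ _+_ (f≡g 0 z<s) (∑<-cong n (λ i i<n → f≡g (suc i) (s<s i<n)))

∑<-distrib-+ : ∀ n (f g : ℕ → ℕ) → ∑[ i < n ] (f i + g i) ≡ ∑< n f + ∑< n g
∑<-distrib-+ zero    f g = refl
∑<-distrib-+ (suc n) f g = trans (cong (f 0 + g 0 +_) (∑<-distrib-+ n (f ∘ suc) (g ∘ suc)))
                                 (interchange (f 0) (g 0) (∑< n (f ∘ suc)) (∑< n (g ∘ suc)))

∑<-last : ∀ n f → ∑< (suc n) f ≡ ∑< n f + f n
∑<-last zero    f = +-comm (f 0) 0
∑<-last (suc n) f = trans (cong (f 0 +_) (∑<-last n (f ∘ suc))) (sym (+-assoc (f 0) _ _))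

applyDownFrom≡applyUpTo : ∀ {A : Set} (f : ℕ → A) n → applyDownFrom f n ≡ applyUpTo (λ i → f (n ∸ suc i)) n
applyDownFrom≡applyUpTo f zero    = refl
applyDownFrom≡applyUpTo f (suc n) = cong (f n ∷_) (applyDownFrom≡applyUpTo f n)

∑<-reverse : ∀ n f → ∑< n f ≡ ∑[ i < n ] f (n ∸ suc i)
∑<-reverse n f = begin
  sum (applyUpTo f n)            ≡⟨ sum-↭ (↭-reverse (applyUpTo f n)) ⟨
  sum (reverse (applyUpTo f n))  ≡⟨ cong sum (reverse-applyUpTo f n) ⟩
  sum (applyDownFrom f n)        ≡⟨ cong sum (applyDownFrom≡applyUpTo f n) ⟩
  ∑[ i < n ] f (n ∸ suc i)       ∎
  where open ≡-Reasoning

n<k⇒nCk≡0 : ∀ {n k} → n < k → n C k ≡ 0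
n<k⇒nCk≡0 {n} {k} n<k with k ≤ᵇ n in k≤ᵇn
... | true  = ⊥-elim (<⇒≱ n<k (≤ᵇ⇒≤ k n (subst T (sym k≤ᵇn) tt)))
... | false = refl

pascal : ∀ n k → suc n C suc k ≡ n C suc k + n C k
pascal n k = trans (sym (nCk+nC[k+1]≡[n+1]C[k+1] n k)) (+-comm (n C k) (n C suc k))

nCk≤2^n : ∀ n k → n C k ≤ 2 ^ n
nCk≤2^n n       zero    = m^n>0 2 n
nCk≤2^n zero    (suc k) = ≤-trans (≤-reflexive (n<k⇒nCk≡0 {k = suc k} z<s)) z≤n
nCk≤2^n (suc n) (suc k) = begin
  suc n C suc k            ≡⟨ pascal n k ⟩
  n C suc k + n C k        ≤⟨ +-mono-≤ (nCk≤2^n n (suc k)) (nCk≤2^n n k) ⟩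
  2 ^ n + 2 ^ n            ≡⟨ cong (2 ^ n +_) (+-identityʳ (2 ^ n)) ⟨
  2 ^ suc n                ∎
  where open ≤-Reasoning

[1+n]C[1+k]*[1+k]≡nCk*[1+n] : ∀ n k → (suc n C suc k) * suc k ≡ (n C k) * suc n
[1+n]C[1+k]*[1+k]≡nCk*[1+n] zero    zero    = refl
[1+n]C[1+k]*[1+k]≡nCk*[1+n] zero    (suc k) = *-zeroˡ (suc (suc k))
[1+n]C[1+k]*[1+k]≡nCk*[1+n] (suc n) zero    =
  trans (*-identityʳ (suc (suc n) C 1)) (trans (nC1≡n (suc (suc n))) (sym (*-identityˡ (suc (suc n)))))
[1+n]C[1+k]*[1+k]≡nCk*[1+n] (suc n) (suc k) = begin
  (suc (suc n) C suc (suc k)) * suc (suc k)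
    ≡⟨ cong (_* suc (suc k)) (pascal (suc n) (suc k)) ⟩
  (a + b) * suc (suc k)
    ≡⟨ expand a b k ⟩
  a * suc (suc k) + (b * suc k + b)
    ≡⟨ cong₂ (λ x y → x + (y + b)) ([1+n]C[1+k]*[1+k]≡nCk*[1+n] n (suc k)) ([1+n]C[1+k]*[1+k]≡nCk*[1+n] n k) ⟩
  (n C suc k) * suc n + ((n C k) * suc n + b)
    ≡⟨ collect (n C suc k) (n C k) b n ⟩
  (n C suc k + n C k) * suc n + b
    ≡⟨ cong (λ x → x * suc n + b) (pascal n k) ⟨
  b * suc n + b
    ≡⟨ trans (+-comm (b * suc n) b) (sym (*-suc b (suc n))) ⟩
  b * suc (suc n)
    ∎
  where
  open ≡-Reasoning
  a = suc n C suc (suc k)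
  b = suc n C suc k
  expand : ∀ a b k → (a + b) * suc (suc k) ≡ a * suc (suc k) + (b * suc k + b)
  expand = solve-∀
  collect : ∀ a b c n → a * suc n + (b * suc n + c) ≡ (a + b) * suc n + c
  collect = solve-∀

[1+n]Cj*[1+n]≡nCj*[1+n]+[1+n]Cj*j : ∀ n j → (suc n C j) * suc n ≡ (n C j) * suc n + (suc n C j) * j
[1+n]Cj*[1+n]≡nCj*[1+n]+[1+n]Cj*j n zero    = sym (+-identityʳ _)
[1+n]Cj*[1+n]≡nCj*[1+n]+[1+n]Cj*j n (suc k) = begin
  (suc n C suc k) * suc n                      ≡⟨ cong (_* suc n) (pascal n k) ⟩
  (n C suc k + n C k) * suc n                  ≡⟨ *-distribʳ-+ (suc n) (n C suc k) (n C k) ⟩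
  (n C suc k) * suc n + (n C k) * suc n        ≡⟨ cong ((n C suc k) * suc n +_) ([1+n]C[1+k]*[1+k]≡nCk*[1+n] n k) ⟨
  (n C suc k) * suc n + (suc n C suc k) * suc k ∎
  where open ≡-Reasoning

absorb-≤ : ∀ n j h → h ≤ j → (suc n C j) * h ≤ (n C pred j) * suc n
absorb-≤ n zero    .zero z≤n = z≤n
absorb-≤ n (suc k) h   h≤j = ≤-trans (*-monoʳ-≤ (suc n C suc k) h≤j) (≤-reflexive ([1+n]C[1+k]*[1+k]≡nCk*[1+n] n k))

complement-≤ : ∀ n j h → j + h ≤ suc n → (suc n C j) * h ≤ (n C j) * suc n
complement-≤ n j h j+h≤1+n = +-cancelʳ-≤ (c * j) (c * h) ((n C j) * suc n) (begin
  c * h + c * j                  ≡⟨ *-distribˡ-+ c h j ⟨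
  c * (h + j)                    ≤⟨ *-monoʳ-≤ c (≤-trans (≤-reflexive (+-comm h j)) j+h≤1+n) ⟩
  c * suc n                      ≡⟨ [1+n]Cj*[1+n]≡nCj*[1+n]+[1+n]Cj*j n j ⟩
  (n C j) * suc n + c * j        ∎)
  where
  open ≤-Reasoning
  c = suc n C j

-- One of j and n + 1 - j is at least h, so one of the two absorption bounds above applies.
descend : ∀ n j h → h + h ≤ 2 + n → ∃[ i ] (suc n C j) * h ≤ (n C i) * suc n
descend n j h h+h≤2+n with j <? h
... | yes j<h = j , complement-≤ n j h (≤-pred (≤-trans (+-monoˡ-≤ h j<h) h+h≤2+n))
... | no  j≮h = pred j , absorb-≤ n j h (≮⇒≥ j≮h)

[1+n]Cj≤nCi+nCi : ∀ n j → ∃[ i ] suc n C j ≤ n C i + n C i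
[1+n]Cj≤nCi+nCi n zero    = 0 , s≤s z≤n
[1+n]Cj≤nCi+nCi n (suc k) with ≤-total (n C suc k) (n C k)
... | inj₁ ≤ₖ = k     , ≤-trans (≤-reflexive (pascal n k)) (+-monoˡ-≤ (n C k) ≤ₖ)
... | inj₂ ≥ₖ = suc k , ≤-trans (≤-reflexive (pascal n k)) (+-monoʳ-≤ (n C suc k) ≥ₖ)

-- C(n, j) ≤ 2ⁿ / √(n + 1)

infix 4 _·√_≤_

_·√_≤_ : ℕ → ℕ → ℕ → Set
x ·√ c ≤ u = x * x * c ≤ u * u

Row : ℕ → Set
Row n = ∀ j → (n C j) ·√ suc n ≤ 2 ^ n

-- Sharper than Row (suc (n + n)), which would not suffice to reach Row (2 + n + n).
OddRow : ℕ → Set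
OddRow n = ∀ j → let x = (suc (n + n) C j) * suc n; P = 2 ^ (n + n) in
             x * x ≤ P * P * suc (n + n)

Row⇒OddRow : ∀ n → Row (n + n) → OddRow n
Row⇒OddRow n even j with descend (n + n) j (suc n) (≤-reflexive (cong suc (+-suc n n)))
... | i , x≤c*s = begin
  x * x                  ≤⟨ *-mono-≤ x≤c*s x≤c*s ⟩
  (c * s) * (c * s)      ≡⟨ regroup c s ⟩
  c * c * s * s          ≤⟨ *-monoˡ-≤ s (even i) ⟩
  P * P * s              ∎
  where
  open ≤-Reasoning
  x = (suc (n + n) C j) * suc n
  c = (n + n) C i
  s = suc (n + n)
  P = 2 ^ (n + n)
  regroup : ∀ c s → (c * s) * (c * s) ≡ c * c * s * s
  regroup = solve-∀

OddRow⇒Row[1+2n] : ∀ n → OddRow n → Row (suc (n + n))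
OddRow⇒Row[1+2n] n odd j = *-cancelʳ-≤ (c * c * suc s) (2 * P * (2 * P)) (suc n) (begin
  c * c * suc s * suc n              ≡⟨ expand c n ⟩
  2 * ((c * suc n) * (c * suc n))    ≤⟨ *-monoʳ-≤ 2 (odd j) ⟩
  2 * (P * P * s)                    ≤⟨ *-monoʳ-≤ 2 (*-monoʳ-≤ (P * P) (n≤1+n s)) ⟩
  2 * (P * P * suc s)                ≡⟨ collect P n ⟩
  2 * P * (2 * P) * suc n            ∎)
  where
  open ≤-Reasoning
  c = suc (n + n) C j
  s = suc (n + n)
  P = 2 ^ (n + n)
  expand : ∀ c n → c * c * suc (suc (n + n)) * suc n ≡ 2 * ((c * suc n) * (c * suc n))
  expand = solve-∀
  collect : ∀ P n → 2 * (P * P * suc (suc (n + n))) ≡ 2 * P * (2 * P) * suc n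
  collect = solve-∀

OddRow⇒Row[2+2n] : ∀ n → OddRow n → Row (suc (suc (n + n)))
OddRow⇒Row[2+2n] n odd j with [1+n]Cj≤nCi+nCi (suc (n + n)) j
... | i , y≤x+x = *-cancelʳ-≤ (y * y * suc s₂) (2 * (2 * P) * (2 * (2 * P))) (suc n * suc n) (begin
  y * y * suc s₂ * (suc n * suc n)              ≤⟨ *-monoˡ-≤ (suc n * suc n) (*-monoˡ-≤ (suc s₂) (*-mono-≤ y≤x+x y≤x+x)) ⟩
  (x + x) * (x + x) * suc s₂ * (suc n * suc n)  ≡⟨ expand x n ⟩
  4 * ((x * suc n) * (x * suc n)) * suc s₂      ≤⟨ *-monoˡ-≤ (suc s₂) (*-monoʳ-≤ 4 (odd i)) ⟩
  4 * (P * P * s₁) * suc s₂                     ≡⟨ reassoc P s₁ (suc s₂) ⟩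
  4 * (P * P) * (s₁ * suc s₂)                   ≤⟨ *-monoʳ-≤ (4 * (P * P)) ([2n+1][2n+3]≤[2n+2]² n) ⟩
  4 * (P * P) * (s₂ * s₂)                       ≡⟨ collect P n ⟩
  2 * (2 * P) * (2 * (2 * P)) * (suc n * suc n) ∎)
  where
  open ≤-Reasoning
  y = suc (suc (n + n)) C j
  x = suc (n + n) C i
  s₁ = suc (n + n)
  s₂ = suc s₁
  P = 2 ^ (n + n)
  expand : ∀ x n → (x + x) * (x + x) * suc (suc (suc (n + n))) * (suc n * suc n)
             ≡ 4 * ((x * suc n) * (x * suc n)) * suc (suc (suc (n + n)))
  expand = solve-∀
  reassoc : ∀ P a b → 4 * (P * P * a) * b ≡ 4 * (P * P) * (a * b)
  reassoc = solve-∀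
  collect : ∀ P n → 4 * (P * P) * (suc (suc (n + n)) * suc (suc (n + n))) ≡ 2 * (2 * P) * (2 * (2 * P)) * (suc n * suc n)
  collect = solve-∀
  [2n+1][2n+3]≤[2n+2]² : ∀ n → suc (n + n) * suc (suc (suc (n + n))) ≤ suc (suc (n + n)) * suc (suc (n + n))
  [2n+1][2n+3]≤[2n+2]² n = ≤-trans (n≤1+n _) (≤-reflexive ([2n+1][2n+3]+1≡[2n+2]² n))
    where
    [2n+1][2n+3]+1≡[2n+2]² : ∀ n → suc (suc (n + n) * suc (suc (suc (n + n)))) ≡ suc (suc (n + n)) * suc (suc (n + n))
    [2n+1][2n+3]+1≡[2n+2]² = solve-∀

row-bound-even : ∀ n → Row (n + n)
row-bound-even zero    zero    = ≤-refl
row-bound-even zero    (suc k) = z≤n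
row-bound-even (suc n) = subst Row (cong suc (sym (+-suc n n))) (OddRow⇒Row[2+2n] n (Row⇒OddRow n (row-bound-even n)))

parity : ∀ n → ∃[ k ] (n ≡ k + k ⊎ n ≡ suc (k + k))
parity zero = 0 , inj₁ refl
parity (suc n) with parity n
... | k , inj₁ refl = k , inj₂ refl
... | k , inj₂ refl = suc k , inj₁ (cong suc (sym (+-suc k k)))

row-bound : ∀ n → Row n
row-bound n with parity n
... | k , inj₁ refl = row-bound-even k
... | k , inj₂ refl = OddRow⇒Row[1+2n] k (Row⇒OddRow k (row-bound-even k))

-- The functionals Φ and Ψ

mutual
  Φ : ℕ → (ℕ → ℕ) → ℕ
  Φ zero    g = g 0
  Φ (suc m) g = Φ m (g ∘ suc) + Ψ m g

  Ψ : ℕ → (ℕ → ℕ) → ℕ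
  Ψ zero    g = g 0
  Ψ (suc m) g = Φ m g + Ψ m g

m*m≤n*n⇒m≤n : ∀ {m n} → m * m ≤ n * n → m ≤ n
m*m≤n*n⇒m≤n m*m≤n*n = ≮⇒≥ (λ n<m → <⇒≱ (*-mono-< n<m n<m) m*m≤n*n)

·√-+ : ∀ {c x y u v} → x ·√ c ≤ u → y ·√ c ≤ v → (x + y) ·√ c ≤ u + v
·√-+ {c} {x} {y} {u} {v} x√c≤u y√c≤v = begin
  (x + y) * (x + y) * c                          ≡⟨ expand x y c ⟩
  x * x * c + 2 * (x * y * c) + y * y * c        ≤⟨ +-mono-≤ (+-mono-≤ x√c≤u (*-monoʳ-≤ 2 cross)) y√c≤v ⟩
  u * u + 2 * (u * v) + v * v                    ≡⟨ square-+ u v ⟩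
  (u + v) * (u + v)                              ∎
  where
  open ≤-Reasoning
  expand : ∀ x y c → (x + y) * (x + y) * c ≡ x * x * c + 2 * (x * y * c) + y * y * c
  expand = solve-∀
  square-+ : ∀ u v → u * u + 2 * (u * v) + v * v ≡ (u + v) * (u + v)
  square-+ = solve-∀
  regroup : ∀ x y c → (x * y * c) * (x * y * c) ≡ (x * x * c) * (y * y * c)
  regroup = solve-∀
  square-* : ∀ x y → (x * y) * (x * y) ≡ (x * x) * (y * y)
  square-* = solve-∀
  cross : x * y * c ≤ u * v
  cross = m*m≤n*n⇒m≤n (begin
    (x * y * c) * (x * y * c)  ≡⟨ regroup x y c ⟩
    (x * x * c) * (y * y * c)  ≤⟨ *-mono-≤ x√c≤u y√c≤v ⟩
    (u * u) * (v * v)          ≡⟨ square-* u v ⟨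
    (u * v) * (u * v)          ∎)

module _ (R : ℕ → ℕ → Set) (R-+ : ∀ {a b c d} → R a b → R c d → R (a + c) (b + d)) where
  mutual
    Φ-preserves : ∀ m {f g} → (∀ N → N ≤ m → R (f N) (g N)) → R (Φ m f) (Φ m g)
    Φ-preserves zero    fRg = fRg 0 z≤n
    Φ-preserves (suc m) fRg = R-+ (Φ-preserves m (λ N N≤m → fRg (suc N) (s≤s N≤m)))
                                  (Ψ-preserves m (λ N N≤m → fRg N (m≤n⇒m≤1+n N≤m)))

    Ψ-preserves : ∀ m {f g} → (∀ N → N ≤ m → R (f N) (g N)) → R (Ψ m f) (Ψ m g)
    Ψ-preserves zero    fRg = fRg 0 z≤n
    Ψ-preserves (suc m) fRg = R-+ (Φ-preserves m (λ N N≤m → fRg N (m≤n⇒m≤1+n N≤m)))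
                                  (Ψ-preserves m (λ N N≤m → fRg N (m≤n⇒m≤1+n N≤m)))

Φ-cong : ∀ m {f g} → (∀ N → N ≤ m → f N ≡ g N) → Φ m f ≡ Φ m g
Φ-cong = Φ-preserves _≡_ (cong₂ _+_)

Ψ-cong : ∀ m {f g} → (∀ N → N ≤ m → f N ≡ g N) → Ψ m f ≡ Ψ m g
Ψ-cong = Ψ-preserves _≡_ (cong₂ _+_)

Φ-mono : ∀ m {f g} → (∀ N → f N ≤ g N) → Φ m f ≤ Φ m g
Φ-mono m f≤g = Φ-preserves _≤_ +-mono-≤ m (λ N _ → f≤g N)

Φ-·√ : ∀ m {c f g} → (∀ N → f N ·√ c ≤ g N) → Φ m f ·√ c ≤ Φ m g
Φ-·√ m {c} f√c≤g = Φ-preserves (λ x u → x ·√ c ≤ u) (λ {x} {u} {y} {v} → ·√-+ {c} {x} {y} {u} {v}) m (λ N _ → f√c≤g N)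

Φ-scale : ∀ m c f → Φ m (λ N → c * f N) ≡ c * Φ m f
Φ-scale m c f = Φ-preserves (λ x y → y ≡ c * x) (λ p q → trans (cong₂ _+_ p q) (sym (*-distribˡ-+ c _ _)))
                            m {f} {λ N → c * f N} (λ N _ → refl)

mutual
  Φ-+ : ∀ m f g → Φ m (λ N → f N + g N) ≡ Φ m f + Φ m g
  Φ-+ zero    f g = refl
  Φ-+ (suc m) f g = trans (cong₂ _+_ (Φ-+ m (f ∘ suc) (g ∘ suc)) (Ψ-+ m f g))
                          (interchange (Φ m (f ∘ suc)) (Φ m (g ∘ suc)) (Ψ m f) (Ψ m g))

  Ψ-+ : ∀ m f g → Ψ m (λ N → f N + g N) ≡ Ψ m f + Ψ m g
  Ψ-+ zero    f g = refl
  Ψ-+ (suc m) f g = trans (cong₂ _+_ (Φ-+ m f g) (Ψ-+ m f g)) (interchange (Φ m f) (Φ m g) (Ψ m f) (Ψ m g))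

a*c+a*c≡2*a*c : ∀ a c → a * c + a * c ≡ 2 * a * c
a*c+a*c≡2*a*c = solve-∀

mutual
  Φ-const : ∀ m c → Φ m (λ _ → c) ≡ 2 ^ m * c
  Φ-const zero    c = sym (*-identityˡ c)
  Φ-const (suc m) c = trans (cong₂ _+_ (Φ-const m c) (Ψ-const m c)) (a*c+a*c≡2*a*c (2 ^ m) c)

  Ψ-const : ∀ m c → Ψ m (λ _ → c) ≡ 2 ^ m * c
  Ψ-const zero    c = sym (*-identityˡ c)
  Ψ-const (suc m) c = trans (cong₂ _+_ (Φ-const m c) (Ψ-const m c)) (a*c+a*c≡2*a*c (2 ^ m) c)

Φ-vanishes : ∀ m {f} → (∀ N → N ≤ m → f N ≡ 0) → Φ m f ≡ 0
Φ-vanishes m f≡0 = trans (Φ-cong m f≡0) (trans (Φ-const m 0) (*-zeroʳ (2 ^ m)))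

Ψ-vanishes : ∀ m {f} → (∀ N → N ≤ m → f N ≡ 0) → Ψ m f ≡ 0
Ψ-vanishes m f≡0 = trans (Ψ-cong m f≡0) (trans (Ψ-const m 0) (*-zeroʳ (2 ^ m)))

Φ-shift : ∀ m {f g} → (∀ N → f (suc N) ≡ f N + g N) → Φ m (f ∘ suc) ≡ Φ m f + Φ m g
Φ-shift m {f} {g} step = trans (Φ-cong m (λ N _ → step N)) (Φ-+ m f g)

Φ-recurrence : ∀ m {f g} → (∀ N → f (suc N) ≡ f N + g N)
             → Φ (suc (suc m)) f + Φ m g ≡ Φ (suc m) f + Φ (suc m) f + Φ (suc m) g
Φ-recurrence m {f} {g} step = begin
  Φ (suc m) (f ∘ suc) + (Φ m f + Ψ m f) + Φ m g
    ≡⟨ cong (λ x → x + (Φ m f + Ψ m f) + Φ m g) (Φ-shift (suc m) step) ⟩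
  Φ (suc m) f + Φ (suc m) g + (Φ m f + Ψ m f) + Φ m g
    ≡⟨ rearrange (Φ (suc m) f) (Φ (suc m) g) (Φ m f) (Ψ m f) (Φ m g) ⟩
  Φ (suc m) f + (Φ m f + Φ m g + Ψ m f) + Φ (suc m) g
    ≡⟨ cong (λ x → Φ (suc m) f + (x + Ψ m f) + Φ (suc m) g) (Φ-shift m step) ⟨
  Φ (suc m) f + Φ (suc m) f + Φ (suc m) g
    ∎
  where
  open ≡-Reasoning
  rearrange : ∀ F G a p b → F + G + (a + p) + b ≡ F + (a + b + p) + G
  rearrange = solve-∀

Φ-diag : ∀ j → Φ j (λ N → N C j) ≡ 1
Φ-diag zero    = refl
Φ-diag (suc j) = begin
  Φ j (λ N → suc N C suc j) + Ψ j (λ N → N C suc j)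
    ≡⟨ cong₂ _+_ (Φ-shift j (λ N → pascal N j)) (Ψ-vanishes j C[≤j][1+j]≡0) ⟩
  Φ j (λ N → N C suc j) + Φ j (λ N → N C j) + 0
    ≡⟨ cong₂ (λ a b → a + b + 0) (Φ-vanishes j C[≤j][1+j]≡0) (Φ-diag j) ⟩
  1 ∎
  where
  open ≡-Reasoning
  C[≤j][1+j]≡0 : ∀ N → N ≤ j → N C suc j ≡ 0
  C[≤j][1+j]≡0 N N≤j = n<k⇒nCk≡0 (s≤s N≤j)

-- τ as a binomial mixture

G H : ℕ → ℕ → ℕ
G n j = ∑[ a < suc n ] (((a + j) C j) * (n C a))
H n j = ∑[ a < suc n ] ((suc (a + j) C j) * (n C a))

τ≡G : ∀ n j → τ (n + j) j ≡ G n j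
τ≡G n j = begin
  τ (n + j) j
    ≡⟨ cong (λ k → sum (map (λ i → ((n + j ∸ i) C j) * (k C i)) (upTo (suc k)))) (m+n∸n≡m n j) ⟩
  sum (map (λ i → ((n + j ∸ i) C j) * (n C i)) (upTo (suc n)))
    ≡⟨ cong sum (map-upTo _ (suc n)) ⟩
  ∑[ i < suc n ] (((n + j ∸ i) C j) * (n C i))
    ≡⟨ ∑<-reverse (suc n) (λ i → ((n + j ∸ i) C j) * (n C i)) ⟩
  ∑[ a < suc n ] (((n + j ∸ (n ∸ a)) C j) * (n C (n ∸ a)))
    ≡⟨ ∑<-cong (suc n) (λ a a<1+n → reindex (≤-pred a<1+n)) ⟩
  G n j
    ∎
  where
  open ≡-Reasoning
  reindex : ∀ {a} → a ≤ n → ((n + j ∸ (n ∸ a)) C j) * (n C (n ∸ a)) ≡ ((a + j) C j) * (n C a)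
  reindex {a} a≤n = cong₂ _*_
    (cong (_C j) (trans (+-∸-comm j (m∸n≤m n a)) (cong (_+ j) (m∸[m∸n]≡n a≤n))))
    (sym (nCk≡nC[n∸k] a≤n))

G-split : ∀ n j → G (suc n) j ≡ G n j + H n j
G-split n j = begin
  (j C j) * 1 + ∑[ a < suc n ] ((suc (a + j) C j) * (suc n C suc a))
    ≡⟨ cong ((j C j) * 1 +_) (∑<-cong (suc n) (λ a _ → pascal-right a)) ⟩
  (j C j) * 1 + ∑[ a < suc n ] ((suc (a + j) C j) * (n C suc a) + (suc (a + j) C j) * (n C a))
    ≡⟨ cong ((j C j) * 1 +_) (∑<-distrib-+ (suc n) (λ a → (suc (a + j) C j) * (n C suc a)) (λ a → (suc (a + j) C j) * (n C a))) ⟩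
  (j C j) * 1 + (∑[ a < suc n ] ((suc (a + j) C j) * (n C suc a)) + H n j)
    ≡⟨ cong (λ x → (j C j) * 1 + (x + H n j)) (∑<-last n (λ a → (suc (a + j) C j) * (n C suc a))) ⟩
  (j C j) * 1 + (R + (suc (n + j) C j) * (n C suc n) + H n j)
    ≡⟨ cong (λ x → (j C j) * 1 + (R + x + H n j)) top≡0 ⟩
  (j C j) * 1 + (R + 0 + H n j)
    ≡⟨ rearrange ((j C j) * 1) R (H n j) ⟩
  (j C j) * 1 + R + H n j
    ∎
  where
  open ≡-Reasoning
  R = ∑[ a < n ] ((suc (a + j) C j) * (n C suc a))
  pascal-right : ∀ a → (suc (a + j) C j) * (suc n C suc a)
                     ≡ (suc (a + j) C j) * (n C suc a) + (suc (a + j) C j) * (n C a)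
  pascal-right a = trans (cong ((suc (a + j) C j) *_) (pascal n a)) (*-distribˡ-+ (suc (a + j) C j) (n C suc a) (n C a))
  top≡0 : (suc (n + j) C j) * (n C suc n) ≡ 0
  top≡0 = trans (cong ((suc (n + j) C j) *_) (n<k⇒nCk≡0 (n<1+n n))) (*-zeroʳ (suc (n + j) C j))
  rearrange : ∀ a r h → a + (r + 0 + h) ≡ a + r + h
  rearrange = solve-∀

H-split : ∀ n j → H n (suc j) ≡ G n (suc j) + H n j
H-split n j = trans (∑<-cong (suc n) (λ a _ → pascal-left a))
                    (∑<-distrib-+ (suc n) (λ a → ((a + suc j) C suc j) * (n C a)) (λ a → (suc (a + j) C j) * (n C a)))
  where
  pascal-left : ∀ a → (suc (a + suc j) C suc j) * (n C a)
                    ≡ ((a + suc j) C suc j) * (n C a) + (suc (a + j) C j) * (n C a)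
  pascal-left a = trans (cong (_* (n C a)) (trans (pascal (a + suc j) j) (cong (λ k → (a + suc j) C suc j + k C j) (+-suc a j))))
                        (*-distribʳ-+ (n C a) ((a + suc j) C suc j) (suc (a + j) C j))

G-recurrence : ∀ n j → G (suc n) (suc j) + G n j ≡ G n (suc j) + G n (suc j) + G (suc n) j
G-recurrence n j = begin
  G (suc n) (suc j) + G n j                   ≡⟨ cong (_+ G n j) (trans (G-split n (suc j)) (cong (G n (suc j) +_) (H-split n j))) ⟩
  G n (suc j) + (G n (suc j) + H n j) + G n j  ≡⟨ rearrange (G n (suc j)) (H n j) (G n j) ⟩
  G n (suc j) + G n (suc j) + (G n j + H n j)  ≡⟨ cong (G n (suc j) + G n (suc j) +_) (G-split n j) ⟨
  G n (suc j) + G n (suc j) + G (suc n) j      ∎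
  where
  open ≡-Reasoning
  rearrange : ∀ a h b → a + (a + h) + b ≡ a + a + (b + h)
  rearrange = solve-∀

G[0,j]≡1 : ∀ j → G 0 j ≡ 1
G[0,j]≡1 j = trans (+-identityʳ _) (trans (*-identityʳ (j C j)) (nCn≡1 j))

G[n,0]≡2^n : ∀ n → G n 0 ≡ 2 ^ n
G[n,0]≡2^n zero    = refl
G[n,0]≡2^n (suc n) = trans (G-split n 0) (trans (cong₂ _+_ (G[n,0]≡2^n n) (G[n,0]≡2^n n)) (cong (2 ^ n +_) (sym (+-identityʳ _))))

G≡Φ : ∀ n j → G n j ≡ Φ (n + j) (λ N → N C j)
G≡Φ n       zero    = trans (G[n,0]≡2^n n) (sym (trans (cong (λ m → Φ m (λ _ → 1)) (+-identityʳ n))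
                                                   (trans (Φ-const n 1) (*-identityʳ (2 ^ n)))))
G≡Φ zero    (suc j) = trans (G[0,j]≡1 (suc j)) (sym (Φ-diag (suc j)))
G≡Φ (suc n) (suc j) = trans (+-cancelʳ-≡ (G n j) _ _ (begin
  G (suc n) (suc j) + G n j                               ≡⟨ G-recurrence n j ⟩
  G n (suc j) + G n (suc j) + G (suc n) j                 ≡⟨ cong₂ (λ a b → a + a + b) G≡Φ[n,1+j] (G≡Φ (suc n) j) ⟩
  ΦC (suc m) (suc j) + ΦC (suc m) (suc j) + ΦC (suc m) j  ≡⟨ Φ-recurrence m (λ N → pascal N j) ⟨
  ΦC (suc (suc m)) (suc j) + ΦC m j                       ≡⟨ cong (ΦC (suc (suc m)) (suc j) +_) (G≡Φ n j) ⟨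
  ΦC (suc (suc m)) (suc j) + G n j                        ∎))
  (cong (λ k → ΦC (suc k) (suc j)) (sym (+-suc n j)))
  where
  open ≡-Reasoning
  ΦC : ℕ → ℕ → ℕ
  ΦC m j = Φ m (λ N → N C j)
  m = n + j
  G≡Φ[n,1+j] : G n (suc j) ≡ ΦC (suc m) (suc j)
  G≡Φ[n,1+j] = trans (G≡Φ n (suc j)) (cong (λ k → ΦC k (suc j)) (+-suc n j))

τ≡Φ : ∀ m j → j ≤ m → τ m j ≡ Φ m (λ N → N C j)
τ≡Φ m j j≤m = subst (λ k → τ k j ≡ Φ k (λ N → N C j)) (m∸n+n≡m j≤m) (trans (τ≡G (m ∸ j) j) (G≡Φ (m ∸ j) j))

lucas-+ : ∀ n k → lucas (suc n + k) ≡ fib n * lucas k + fib (suc n) * lucas (suc k)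
lucas-+ zero          k = sym (+-identityʳ (lucas (suc k)))
lucas-+ (suc zero)    k = trans (+-comm (lucas (suc k)) (lucas k)) (cong₂ _+_ (sym (+-identityʳ (lucas k))) (sym (+-identityʳ (lucas (suc k)))))
lucas-+ (suc (suc n)) k = trans (cong₂ _+_ (lucas-+ (suc n) k) (lucas-+ n k)) (combine (fib n) (fib (suc n)) (lucas k) (lucas (suc k)))
  where
  combine : ∀ f₀ f₁ a b → (f₁ * a + (f₁ + f₀) * b) + (f₀ * a + f₁ * b) ≡ (f₁ + f₀) * a + ((f₁ + f₀) + f₁) * b
  combine = solve-∀

lucas-mono : ∀ k → 1 ≤ k → lucas k ≤ lucas (suc k)
lucas-mono (suc k) _ = m≤m+n (lucas (suc k)) (lucas k)

5*lucas≤lucas[4+k] : ∀ k → 1 ≤ k → 5 * lucas k ≤ lucas (4 + k)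
5*lucas≤lucas[4+k] k 1≤k = begin
  5 * lucas k                      ≡⟨ *-distribʳ-+ (lucas k) 2 3 ⟩
  2 * lucas k + 3 * lucas k        ≤⟨ +-monoʳ-≤ (2 * lucas k) (*-monoʳ-≤ 3 (lucas-mono k 1≤k)) ⟩
  2 * lucas k + 3 * lucas (suc k)  ≡⟨ lucas-+ 3 k ⟨
  lucas (4 + k)                    ∎
  where open ≤-Reasoning

lucas[4+k]≤8*lucas : ∀ k → 2 ≤ k → lucas (4 + k) ≤ 8 * lucas k
lucas[4+k]≤8*lucas k@(suc (suc k′)) (s≤s (s≤s z≤n)) = begin
  lucas (4 + k)                          ≡⟨ lucas-+ 3 k ⟩
  2 * lucas k + 3 * lucas (suc k)        ≤⟨ +-monoʳ-≤ (2 * lucas k) (*-monoʳ-≤ 3 (+-monoʳ-≤ (lucas k) (lucas-mono (suc k′) (s≤s z≤n)))) ⟩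
  2 * lucas k + 3 * (lucas k + lucas k)  ≡⟨ eight (lucas k) ⟩
  8 * lucas k                            ∎
  where
  open ≤-Reasoning
  eight : ∀ a → 2 * a + 3 * (a + a) ≡ 8 * a
  eight = solve-∀

5^m≤lucas[4m] : ∀ m → 5 ^ m ≤ lucas (m * 4)
5^m≤lucas[4m] zero          = s≤s z≤n
5^m≤lucas[4m] (suc zero)    = m≤m+n 5 2
5^m≤lucas[4m] (suc (suc m)) = ≤-trans (*-monoʳ-≤ 5 (5^m≤lucas[4m] (suc m))) (5*lucas≤lucas[4+k] (suc m * 4) (s≤s z≤n))

W V : ℕ → ℕ
W m = Φ m (2 ^_)
V m = Ψ m (2 ^_)

W-suc : ∀ m → W (suc m) ≡ 2 * W m + V m
W-suc m = cong (_+ V m) (Φ-scale m 2 (2 ^_))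

-- With W m = F (2m + 2), V m = F (2m + 1) and k = 4m + 2 these are the identities
-- 5 Fₙ² = L₂ₙ - 2 (-1)ⁿ and 5 Fₙ Fₙ₊₁ = L₂ₙ₊₁ + (-1)ⁿ.
LucasTriple : ℕ → ℕ → ℕ → Set
LucasTriple k w v = (5 * (w * w) + 2 ≡ lucas (2 + k))
                  × (5 * (w * v) ≡ lucas (1 + k) + 1)
                  × (5 * (v * v) ≡ lucas k + 2)

LucasTriple-step : ∀ k {w v} → LucasTriple k w v → LucasTriple (4 + k) (2 * w + v) (w + v)
LucasTriple-step k {w} {v} (ww , wv , vv) = step-ww , step-wv , step-vv
  where
  open ≡-Reasoning
  p = lucas k
  q = lucas (suc k)
  step-ww : 5 * ((2 * w + v) * (2 * w + v)) + 2 ≡ lucas (6 + k)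
  step-ww = +-cancelʳ-≡ 8 _ _ (begin
    5 * ((2 * w + v) * (2 * w + v)) + 2 + 8                      ≡⟨ expand w v ⟩
    4 * (5 * (w * w) + 2) + 4 * (5 * (w * v)) + 5 * (v * v) + 2  ≡⟨ cong₂ (λ a b → 4 * a + 4 * b + 5 * (v * v) + 2) ww wv ⟩
    4 * (q + p) + 4 * (q + 1) + 5 * (v * v) + 2                  ≡⟨ cong (λ c → 4 * (q + p) + 4 * (q + 1) + c + 2) vv ⟩
    4 * (q + p) + 4 * (q + 1) + (p + 2) + 2                      ≡⟨ collect p q ⟩
    fib 5 * p + fib 6 * q + 8                                    ≡⟨ cong (_+ 8) (lucas-+ 5 k) ⟨
    lucas (6 + k) + 8                                            ∎)
    where
    expand : ∀ w v → 5 * ((2 * w + v) * (2 * w + v)) + 2 + 8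
                   ≡ 4 * (5 * (w * w) + 2) + 4 * (5 * (w * v)) + 5 * (v * v) + 2
    expand = solve-∀
    collect : ∀ p q → 4 * (q + p) + 4 * (q + 1) + (p + 2) + 2 ≡ 5 * p + 8 * q + 8
    collect = solve-∀
  step-wv : 5 * ((2 * w + v) * (w + v)) ≡ lucas (5 + k) + 1
  step-wv = +-cancelʳ-≡ 4 _ _ (begin
    5 * ((2 * w + v) * (w + v)) + 4                              ≡⟨ expand w v ⟩
    2 * (5 * (w * w) + 2) + 3 * (5 * (w * v)) + 5 * (v * v)      ≡⟨ cong₂ (λ a b → 2 * a + 3 * b + 5 * (v * v)) ww wv ⟩
    2 * (q + p) + 3 * (q + 1) + 5 * (v * v)                      ≡⟨ cong (2 * (q + p) + 3 * (q + 1) +_) vv ⟩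
    2 * (q + p) + 3 * (q + 1) + (p + 2)                          ≡⟨ collect p q ⟩
    fib 4 * p + fib 5 * q + 1 + 4                                ≡⟨ cong (λ x → x + 1 + 4) (lucas-+ 4 k) ⟨
    lucas (5 + k) + 1 + 4                                        ∎)
    where
    expand : ∀ w v → 5 * ((2 * w + v) * (w + v)) + 4 ≡ 2 * (5 * (w * w) + 2) + 3 * (5 * (w * v)) + 5 * (v * v)
    expand = solve-∀
    collect : ∀ p q → 2 * (q + p) + 3 * (q + 1) + (p + 2) ≡ 3 * p + 5 * q + 1 + 4
    collect = solve-∀
  step-vv : 5 * ((w + v) * (w + v)) ≡ lucas (4 + k) + 2
  step-vv = +-cancelʳ-≡ 2 _ _ (begin
    5 * ((w + v) * (w + v)) + 2                                  ≡⟨ expand w v ⟩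
    (5 * (w * w) + 2) + 2 * (5 * (w * v)) + 5 * (v * v)          ≡⟨ cong₂ (λ a b → a + 2 * b + 5 * (v * v)) ww wv ⟩
    (q + p) + 2 * (q + 1) + 5 * (v * v)                          ≡⟨ cong ((q + p) + 2 * (q + 1) +_) vv ⟩
    (q + p) + 2 * (q + 1) + (p + 2)                              ≡⟨ collect p q ⟩
    fib 3 * p + fib 4 * q + 2 + 2                                ≡⟨ cong (λ x → x + 2 + 2) (lucas-+ 3 k) ⟨
    lucas (4 + k) + 2 + 2                                        ∎)
    where
    expand : ∀ w v → 5 * ((w + v) * (w + v)) + 2 ≡ (5 * (w * w) + 2) + 2 * (5 * (w * v)) + 5 * (v * v)
    expand = solve-∀
    collect : ∀ p q → (q + p) + 2 * (q + 1) + (p + 2) ≡ 2 * p + 3 * q + 2 + 2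
    collect = solve-∀

lucas-W-V : ∀ m → LucasTriple (2 + m * 4) (W m) (V m)
lucas-W-V zero    = refl , refl , refl
lucas-W-V (suc m) = subst (λ w → LucasTriple (2 + suc m * 4) w (V (suc m))) (sym (W-suc m))
                          (LucasTriple-step (2 + m * 4) {W m} {V m} (lucas-W-V m))

W²≤2*lucas[4m] : ∀ m → 1 ≤ m → W m * W m ≤ 2 * lucas (m * 4)
W²≤2*lucas[4m] m@(suc _) _ = *-cancelˡ-≤ 5 (begin
  5 * (W m * W m)           ≤⟨ m≤m+n _ 2 ⟩
  5 * (W m * W m) + 2       ≡⟨ proj₁ (lucas-W-V m) ⟩
  lucas (4 + m * 4)         ≤⟨ lucas[4+k]≤8*lucas (m * 4) (s≤s (s≤s z≤n)) ⟩
  8 * lucas (m * 4)         ≤⟨ *-monoˡ-≤ (lucas (m * 4)) (m≤m+n 8 2) ⟩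
  10 * lucas (m * 4)        ≡⟨ *-assoc 5 2 (lucas (m * 4)) ⟩
  5 * (2 * lucas (m * 4))   ∎)
  where open ≤-Reasoning

a^K*[1+K]≤b^K : ∀ {a b} → 2 * a ≤ b → ∀ K → a ^ K * suc K ≤ b ^ K
a^K*[1+K]≤b^K         2a≤b zero    = ≤-refl
a^K*[1+K]≤b^K {a} {b} 2a≤b (suc K) = begin
  a * a ^ K * suc (suc K)          ≤⟨ *-monoʳ-≤ (a * a ^ K) (s≤s (m≤n+m (suc K) K)) ⟩
  a * a ^ K * (suc K + suc K)      ≡⟨ regroup a (a ^ K) K ⟩
  2 * a * (a ^ K * suc K)          ≤⟨ *-mono-≤ 2a≤b (a^K*[1+K]≤b^K 2a≤b K) ⟩
  b * b ^ K                        ∎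
  where
  open ≤-Reasoning
  regroup : ∀ a x K → a * x * (suc K + suc K) ≡ 2 * a * (x * suc K)
  regroup = solve-∀

-- The variable part of each exponent comes first and 2 ^ 30 * 16 ≡ 2 ^ 34 is a separate step:
-- otherwise conversion checking would unfold these literals in unary.
[2^m*2^K]²*m≤2³⁴*5^m : ∀ m K → K * 16 ≤ m → m ≤ 15 + K * 16 → (2 ^ m * 2 ^ K) * (2 ^ m * 2 ^ K) * m ≤ 2 ^ 34 * 5 ^ m
[2^m*2^K]²*m≤2³⁴*5^m m K lo hi = begin
  (2 ^ m * 2 ^ K) * (2 ^ m * 2 ^ K) * m
    ≡⟨ cong (_* m) (trans (^-distribˡ-+-* 2 (m + K) (m + K)) (cong (λ x → x * x) (^-distribˡ-+-* 2 m K))) ⟨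
  2 ^ (m + K + (m + K)) * m
    ≤⟨ *-mono-≤ (^-monoʳ-≤ 2 exponent≤) (m≤n⇒m≤1+n hi) ⟩
  2 ^ (34 * K + 30) * (16 + K * 16)
    ≡⟨ cong (_* (16 + K * 16)) (trans (^-distribˡ-+-* 2 (34 * K) 30) (cong (_* 2 ^ 30) (sym (^-*-assoc 2 34 K)))) ⟩
  (2 ^ 34) ^ K * 2 ^ 30 * (16 + K * 16)
    ≡⟨ regroup ((2 ^ 34) ^ K) (2 ^ 30) K ⟩
  2 ^ 30 * 16 * ((2 ^ 34) ^ K * suc K)
    ≡⟨ cong (_* ((2 ^ 34) ^ K * suc K)) 2³⁰*16≡2³⁴ ⟩
  2 ^ 34 * ((2 ^ 34) ^ K * suc K)
    ≤⟨ *-monoʳ-≤ (2 ^ 34) (a^K*[1+K]≤b^K {2 ^ 34} {5 ^ 16} (toWitness {a? = 2 * 2 ^ 34 ≤? 5 ^ 16} tt) K) ⟩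
  2 ^ 34 * (5 ^ 16) ^ K
    ≡⟨ cong (2 ^ 34 *_) (^-*-assoc 5 16 K) ⟩
  2 ^ 34 * 5 ^ (16 * K)
    ≤⟨ *-monoʳ-≤ (2 ^ 34) (^-monoʳ-≤ 5 (≤-trans (≤-reflexive (*-comm 16 K)) lo)) ⟩
  2 ^ 34 * 5 ^ m
    ∎
  where
  open ≤-Reasoning
  exponent≤ : m + K + (m + K) ≤ 34 * K + 30
  exponent≤ = ≤-trans (+-mono-≤ (+-monoˡ-≤ K hi) (+-monoˡ-≤ K hi)) (≤-reflexive (collect K))
    where
    collect : ∀ K → 15 + K * 16 + K + (15 + K * 16 + K) ≡ 34 * K + 30
    collect = solve-∀
  regroup : ∀ Y c K → Y * c * (16 + K * 16) ≡ c * 16 * (Y * suc K)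
  regroup = solve-∀
  2³⁰*16≡2³⁴ : 2 ^ 30 * 16 ≡ 2 ^ 34
  2³⁰*16≡2³⁴ = refl

-- The truncated difference vanishes for N < K, where N C j ≤ 2 ^ N ≤ 2 ^ K.
excess-bound : ∀ K j N → (N C j ∸ 2 ^ K) ·√ suc K ≤ 2 ^ N
excess-bound K j N with K ≤? N
... | yes K≤N = begin
  (c ∸ 2 ^ K) * (c ∸ 2 ^ K) * suc K  ≤⟨ *-mono-≤ (*-mono-≤ (m∸n≤m c (2 ^ K)) (m∸n≤m c (2 ^ K))) (s≤s K≤N) ⟩
  c * c * suc N                       ≤⟨ row-bound N j ⟩
  2 ^ N * 2 ^ N                       ∎
  where
  open ≤-Reasoning
  c = N C j
... | no  K≰N rewrite m≤n⇒m∸n≡0 (≤-trans (nCk≤2^n N j) (^-monoʳ-≤ 2 (<⇒≤ (≰⇒> K≰N)))) = z≤n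

x≤y⇒[x+y]²≤2[x²+y²] : ∀ {x y} → x ≤ y → (x + y) * (x + y) ≤ 2 * (x * x + y * y)
x≤y⇒[x+y]²≤2[x²+y²] {x} {y} x≤y rewrite sym (m+[n∸m]≡n x≤y) = ≤-trans (m≤m+n _ _) (≤-reflexive (gap x (y ∸ x)))
  where
  gap : ∀ x d → (x + (x + d)) * (x + (x + d)) + d * d ≡ 2 * (x * x + (x + d) * (x + d))
  gap = solve-∀

[x+y]²≤2[x²+y²] : ∀ x y → (x + y) * (x + y) ≤ 2 * (x * x + y * y)
[x+y]²≤2[x²+y²] x y with ≤-total x y
... | inj₁ x≤y = x≤y⇒[x+y]²≤2[x²+y²] x≤y
... | inj₂ y≤x = subst₂ (λ s t → s * s ≤ 2 * t) (+-comm y x) (+-comm (y * y) (x * x)) (x≤y⇒[x+y]²≤2[x²+y²] y≤x)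

τ-split : ∀ m j K → j ≤ m → τ m j ≤ 2 ^ m * 2 ^ K + Φ m (λ N → N C j ∸ 2 ^ K)
τ-split m j K j≤m = begin
  τ m j                                ≡⟨ τ≡Φ m j j≤m ⟩
  Φ m (λ N → N C j)                    ≤⟨ Φ-mono m (λ N → m≤n+m∸n (N C j) (2 ^ K)) ⟩
  Φ m (λ N → 2 ^ K + (N C j ∸ 2 ^ K))  ≡⟨ Φ-+ m (λ _ → 2 ^ K) (λ N → N C j ∸ 2 ^ K) ⟩
  Φ m (λ _ → 2 ^ K) + A                ≡⟨ cong (_+ A) (Φ-const m (2 ^ K)) ⟩
  2 ^ m * 2 ^ K + A                    ∎
  where
  open ≤-Reasoning
  A = Φ m (λ N → N C j ∸ 2 ^ K)

τ-bound : ∀ m j → 1 ≤ m → j ≤ m → 2 * (τ m j ^ 2 * m) ≤ (2 ^ 19) ^ 2 * lucas (4 * m)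
τ-bound m j 1≤m j≤m = begin
  2 * (X ^ 2 * m)                        ≡⟨ cong (λ y → 2 * (X * y * m)) (*-identityʳ X) ⟩
  2 * (X * X * m)                        ≤⟨ *-monoʳ-≤ 2 (*-monoˡ-≤ m (*-mono-≤ X≤B+A X≤B+A)) ⟩
  2 * ((B + A) * (B + A) * m)            ≤⟨ *-monoʳ-≤ 2 (*-monoˡ-≤ m ([x+y]²≤2[x²+y²] B A)) ⟩
  2 * (2 * (B * B + A * A) * m)          ≡⟨ spread (B * B) (A * A) m ⟩
  4 * (B * B * m) + 4 * (A * A * m)      ≤⟨ +-mono-≤ (*-monoʳ-≤ 4 B²m≤) (*-monoʳ-≤ 4 A²m≤) ⟩
  4 * (2 ^ 34 * L) + 4 * (16 * (2 * L))  ≡⟨ collect (2 ^ 34) L ⟩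
  (4 * 2 ^ 34 + 128) * L                 ≤⟨ *-monoˡ-≤ L (toWitness {a? = 4 * 2 ^ 34 + 128 ≤? (2 ^ 19) ^ 2} tt) ⟩
  (2 ^ 19) ^ 2 * L                       ≡⟨ cong (λ k → (2 ^ 19) ^ 2 * lucas k) (*-comm m 4) ⟩
  (2 ^ 19) ^ 2 * lucas (4 * m)           ∎
  where
  open ≤-Reasoning
  spread : ∀ b a m → 2 * (2 * (b + a) * m) ≡ 4 * (b * m) + 4 * (a * m)
  spread = solve-∀
  collect : ∀ c L → 4 * (c * L) + 4 * (16 * (2 * L)) ≡ (4 * c + 128) * L
  collect = solve-∀
  regroup : ∀ A K → A * A * (suc K * 16) ≡ 16 * (A * A * suc K)
  regroup = solve-∀
  K = m / 16
  X = τ m j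
  A = Φ m (λ N → N C j ∸ 2 ^ K)
  B = 2 ^ m * 2 ^ K
  L = lucas (m * 4)
  X≤B+A : X ≤ B + A
  X≤B+A = τ-split m j K j≤m
  lo : K * 16 ≤ m
  lo = ≤-trans (m≤n+m (K * 16) (m % 16)) (≤-reflexive (sym (m≡m%n+[m/n]*n m 16)))
  hi : m ≤ 15 + K * 16
  hi = ≤-trans (≤-reflexive (m≡m%n+[m/n]*n m 16)) (+-monoˡ-≤ (K * 16) (≤-pred (m%n<n m 16)))
  A²m≤ : A * A * m ≤ 16 * (2 * L)
  A²m≤ = begin
    A * A * m             ≤⟨ *-monoʳ-≤ (A * A) (m≤n⇒m≤1+n hi) ⟩
    A * A * (suc K * 16)  ≡⟨ regroup A K ⟩
    16 * (A * A * suc K)  ≤⟨ *-monoʳ-≤ 16 (Φ-·√ m {suc K} {λ N → N C j ∸ 2 ^ K} {2 ^_} (excess-bound K j)) ⟩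
    16 * (W m * W m)      ≤⟨ *-monoʳ-≤ 16 (W²≤2*lucas[4m] m 1≤m) ⟩
    16 * (2 * L)          ∎
  B²m≤ : B * B * m ≤ 2 ^ 34 * L
  B²m≤ = ≤-trans ([2^m*2^K]²*m≤2³⁴*5^m m K lo hi)
                 (*-monoʳ-≤ (2 ^ 34) (5^m≤lucas[4m] m))

maxτ-attained : ∀ m → maxτ m ≡ 0 ⊎ ∃[ j ] j ≤ m × maxτ m ≡ τ m j
maxτ-attained m with foldr-selective ⊔-sel 0 (map (τ m) (upTo (suc m)))
... | inj₁ max≡0    = inj₁ max≡0
... | inj₂ max∈τs with ∈-applyUpTo⁻ (τ m) (subst (maxτ m ∈_) (map-upTo (τ m) (suc m)) max∈τs)
...   | j , j<1+m , max≡τ = inj₂ (j , ≤-pred j<1+m , max≡τ)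

lemma6 : ∃[ C ] ((C > 0) × ((m : ℕ) → 1 ≤ m → ((maxτ m ^ 2) * m) ≤ (C ^ 2) ·φ^ (4 * m)))
lemma6 = 2 ^ 19 , m^n>0 2 19 , λ m 1≤m → inj₁ (maxτ-bound m 1≤m)
  where
  maxτ-bound : ∀ m → 1 ≤ m → 2 * (maxτ m ^ 2 * m) ≤ (2 ^ 19) ^ 2 * lucas (4 * m)
  maxτ-bound m 1≤m = [ (λ max≡0 → subst P (sym max≡0) z≤n)
                     , (λ (j , j≤m , max≡τ) → subst P (sym max≡τ) (τ-bound m j 1≤m j≤m)) ]′ (maxτ-attained m)
    where
    P : ℕ → Set
    P x = 2 * (x ^ 2 * m) ≤ (2 ^ 19) ^ 2 * lucas (4 * m)
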